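{- Let $X$ be a nonempty set, $n\ge1$, and let $\mathcal{U}$ be an $n$-minimal constructible family of subsets of $X$. If $\mathcal{H}\subseteq\mathcal{U}$, then $\mathcal{H}$ is $n$-minimal constructible.
   Context: For a family $\mathcal{U}$ of subsets of $X$, let $C_1(\mathcal{U})$ be the family of all sets of the form $E_1\cap E_2$, $E_1\cup E_2$ or $X\setminus E_1$ with $E_1,E_2\in\mathcal{U}$ (possibly $E_1=E_2$). Set $C_0(\mathcal{U})=\mathcal{U}$ and $C_n(\mathcal{U})=C_1(C_{n-1}(\mathcal{U}))$ for $n\ge1$. A family $\mathcal{U}$ is $n$-minimal constructible ($n\ge1$) if for every proper subfamily $\mathcal{H}\subsetneq\mathcal{U}$ we have $\mathcal{U}\not\subseteq C_n(\mathcal{H})$. -}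

module Defs where

open import Data.Bool using (Bool; true; false; _∧_; _∨_; not)
open import Data.Nat using (ℕ; zero; suc)
open import Data.Product using (Σ; _×_; _,_)
open import Data.Sum using (_⊎_)
open import Relation.Binary.PropositionalEquality using (_≡_)
open import Relation.Nullary using (¬_)

Subset : Set → Set
Subset X = X → Bool

_≐_ : {X : Set} → Subset X → Subset X → Set
A ≐ B = ∀ x → A x ≡ B x

_∩_ _∪_ : {X : Set} → Subset X → Subset X → Subset X
(A ∩ B) x = A x ∧ B x
(A ∪ B) x = A x ∨ B x

compl : {X : Set} → Subset X → Subset X
compl A x = not (A x)

Family : Set → Set
Family X = Subset X → Bool

-- A family is a genuine set of sets: membership respects equality of sets.
Ext : {X : Set} → Family X → Set
Ext F = ∀ A B → A ≐ B → F A ≡ F B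

_∈F_ : {X : Set} → Subset X → Family X → Set
A ∈F F = F A ≡ true

_⊆F_ : {X : Set} → Family X → Family X → Set
H ⊆F U = ∀ A → A ∈F H → A ∈F U

_⊂F_ : {X : Set} → Family X → Family X → Set
H ⊂F U = H ⊆F U × Σ (Subset _) (λ A → A ∈F U × H A ≡ false)

FamP : Set → Set₁
FamP X = Subset X → Set

C₁ : {X : Set} → FamP X → FamP X
C₁ {X} U A = Σ (Subset X) λ E₁ → Σ (Subset X) λ E₂ →
  U E₁ × U E₂ × (A ≐ (E₁ ∩ E₂) ⊎ A ≐ (E₁ ∪ E₂) ⊎ A ≐ compl E₁)

C : {X : Set} → ℕ → Family X → FamP X
C zero    U A = A ∈F U
C (suc n) U   = C₁ (C n U)

NMinimal : {X : Set} → ℕ → Family X → Set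
NMinimal {X} n U = (H : Family X) → Ext H → H ⊂F U →
  ¬ (∀ A → A ∈F U → C n H A)

module Submission where

open import Defs
open import Data.Nat using (ℕ; _≤_; zero; suc)
open import Data.Bool using (true; false; _∧_; _∨_; not)
open import Data.Bool.Properties using (∧-idem; ∧-zeroʳ; ∨-zeroʳ)
open import Data.Product using (_,_)
open import Data.Sum using (inj₁)
open import Relation.Binary.PropositionalEquality using (_≡_; refl; sym; cong; cong₂)

-- If G ⊊ H covers H, then G together with U ∖ H is a proper subfamily of U
-- covering U: members of H are reached through G, the others lie in U ∖ H.

_∪F_ : {X : Set} → Family X → Family X → Family X
(F ∪F G) A = F A ∨ G A

_∖F_ : {X : Set} → Family X → Family X → Family X
(F ∖F G) A = F A ∧ not (G A)

∪F-Ext : {X : Set} {F G : Family X} → Ext F → Ext G → Ext (F ∪F G)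
∪F-Ext eF eG A B A≐B = cong₂ _∨_ (eF A B A≐B) (eG A B A≐B)

∖F-Ext : {X : Set} {F G : Family X} → Ext F → Ext G → Ext (F ∖F G)
∖F-Ext eF eG A B A≐B = cong₂ _∧_ (eF A B A≐B) (cong not (eG A B A≐B))

⊆F-∪Fˡ : {X : Set} (F G : Family X) → F ⊆F (F ∪F G)
⊆F-∪Fˡ F G A A∈F rewrite A∈F = refl

∪F-∖F-⊆F : {X : Set} {G H U : Family X} → G ⊆F U → (G ∪F (U ∖F H)) ⊆F U
∪F-∖F-⊆F {G = G} {U = U} G⊆U A A∈ with G A in A∈G
... | true  = G⊆U A A∈G
... | false with U A
...   | true  = refl
...   | false = A∈

∪F-∖F-⊂F : {X : Set} {G H U : Family X} →
  G ⊂F H → H ⊆F U → (G ∪F (U ∖F H)) ⊂F U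
∪F-∖F-⊂F {G = G} {H} {U} (G⊆H , B , B∈H , B∉G) H⊆U =
  ∪F-∖F-⊆F (λ A A∈G → H⊆U A (G⊆H A A∈G)) , B , H⊆U B B∈H , B∉
  where
  B∉ : (G ∪F (U ∖F H)) B ≡ false
  B∉ rewrite B∉G | B∈H = ∧-zeroʳ (U B)

C-mono : {X : Set} (n : ℕ) {F G : Family X} → F ⊆F G → ∀ A → C n F A → C n G A
C-mono zero    F⊆G A A∈F = F⊆G A A∈F
C-mono (suc n) F⊆G A (E₁ , E₂ , E₁∈ , E₂∈ , A≐) =
  E₁ , E₂ , C-mono n F⊆G E₁ E₁∈ , C-mono n F⊆G E₂ E₂∈ , A≐

-- A = A ∩ A keeps every member alive through each round of C₁.
∈F⇒C : {X : Set} (n : ℕ) (F : Family X) → ∀ A → A ∈F F → C n F A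
∈F⇒C zero    F A A∈F = A∈F
∈F⇒C (suc n) F A A∈F =
  A , A , ∈F⇒C n F A A∈F , ∈F⇒C n F A A∈F , inj₁ (λ x → sym (∧-idem (A x)))

∪F-∖F-covers : {X : Set} (n : ℕ) {G H U : Family X} →
  (∀ A → A ∈F H → C n G A) → ∀ A → A ∈F U → C n (G ∪F (U ∖F H)) A
∪F-∖F-covers n {G} {H} {U} H⊆CG A A∈U with H A in A∈H
... | true  = C-mono n (⊆F-∪Fˡ G (U ∖F H)) A (H⊆CG A A∈H)
... | false = ∈F⇒C n (G ∪F (U ∖F H)) A A∈
  where
  A∈ : (G ∪F (U ∖F H)) A ≡ true
  A∈ rewrite A∈U | A∈H = ∨-zeroʳ (G A)

theorem6p9 : (X : Set) → X → (n : ℕ) → 1 ≤ n →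
    (U : Family X) → Ext U → NMinimal n U →
    (H : Family X) → Ext H → H ⊆F U → NMinimal n H
theorem6p9 X _ n _ U eU minU H eH H⊆U G eG G⊂H H⊆CG =
  minU (G ∪F (U ∖F H)) (∪F-Ext eG (∖F-Ext eU eH))
       (∪F-∖F-⊂F G⊂H H⊆U) (∪F-∖F-covers n H⊆CG)
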